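{- Let $N$, $\Delta$, $r$ be as in the context and assume $\Delta\neq1$. Let $\ell$ be an isotropic line in $V$ and $h\in\mathcal{D}$. If $\mathcal{D}_{\Delta,r}(\ell,h)\neq0$, then $p^2\mid N$ for every prime $p\mid\Delta$. In particular, if $N$ is square-free, then $\mathcal{D}_{\Delta,r}(\ell,h)=0$ for all $\ell$ and $h$.
   Context: $N$ is a positive integer, $\Delta$ a fundamental discriminant, $r\in\mathbb{Z}$ with $\Delta\equiv r^2\pmod{4N}$. $V$ is the space of traceless rational $2\times2$ matrices with $Q(\lambda)=N\det\lambda$, $(\lambda,\mu)=-N\operatorname{tr}(\lambda\mu)$; $L=\{\left(\begin{smallmatrix} b&-a/N\\ c&-b\end{smallmatrix}\right):a,b,c\in\mathbb{Z}\}$, $L'=\{\left(\begin{smallmatrix} b/2N&-a/N\\ c&-b/2N\end{smallmatrix}\right):a,b,c\in\mathbb{Z}\}$, $\mathcal{D}=L'/L$ (cosets of $L$ in $L'$). The genus character: for $\delta=\left(\begin{smallmatrix} b/2N&-a/N\\ c&-b/2N\end{smallmatrix}\right)\in L'$, $\chi_\Delta(\delta)=\left(\frac{\Delta}{n}\right)$ if $\Delta\mid b^2-4Nac$, $(b^2-4Nac)/\Delta$ is a square mod $4N$ and $\gcd(a,b,c,\Delta)=1$, where $n$ is any integer coprime to $\Delta$ represented by $[a,b,Nc]$; otherwise $0$. For an isotropic line $\ell\subset V$, pick $\sigma_\ell\in\mathrm{SL}_2(\mathbb{Z})$ with $\sigma_\ell\ell_\infty\sigma_\ell^{ -1}=\ell$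 where $\ell_\infty=\mathbb{Q}\left(\begin{smallmatrix}0&1\\0&0\end{smallmatrix}\right)$, and let $\lambda_\ell$ be the generator of $\ell\cap L$ that is a positive multiple of $\sigma_\ell\left(\begin{smallmatrix}0&1\\0&0\end{smallmatrix}\right)\sigma_\ell^{ -1}$. For $h\in\mathcal{D}$ let $\delta_\ell(h)=1$ if $\ell\cap(L+h)\neq\emptyset$ and $0$ otherwise. If $\delta_\ell(h)=1$, write $\ell\cap(L+h)=\mathbb{Z}\lambda_\ell+h_\ell$ with $h_\ell=s\lambda_\ell$, $s=p/q$ in lowest terms, and set $d(\ell,h)=q$ and $h'_\ell=\frac{1}{d(\ell,h)}\lambda_\ell$. Define $\mathcal{D}_{\Delta,r}(\ell,h)=\delta_\ell(h)$ if $\Delta=1$; $=\chi_\Delta((rh)'_\ell)$ if $\Delta\neq1$, $\delta_\ell(rh)=1$ and $\Delta\mid d(\ell,rh)$; and $=0$ otherwise. -}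

module Defs where

open import Data.Nat as ℕ using (ℕ; zero; suc; NonZero; _≡ᵇ_)
open import Data.Nat.Properties using (m*n≢0)
open import Data.Nat.Divisibility as ℕD using ()
open import Data.Nat.Primality using (Prime)
open import Data.Nat.DivMod as ℕDM using ()
open import Data.Integer as ℤ using (ℤ; +_; -[1+_]; ∣_∣)
open import Data.Integer.DivMod using (_%ℕ_)
open import Data.Integer.Divisibility as ℤD using ()
open import Data.Integer.GCD as ℤG using ()
open import Data.Rational as ℚ using (ℚ; 0ℚ; 1ℚ; _/_; ↧ₙ_)
open import Data.Bool using (Bool; true; false; if_then_else_; _∨_)
open import Data.Product using (Σ; _×_; _,_; ∃; ∃-syntax)
open import Data.Sum using (_⊎_)
open import Relation.Nullary using (¬_)
open import Relation.Binary.PropositionalEquality using (_≡_; _≢_)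
open import Function.Bundles using (_⇔_)

ι : ℤ → ℚ
ι k = k / 1

ιₙ : ℕ → ℚ
ιₙ n = + n / 1

IsInt : ℚ → Set
IsInt q = ∃[ k ] (q ≡ ι k)

record Mat2 : Set where
  constructor mat
  field
    m11 m12 m21 m22 : ℚ
open Mat2 public

infixl 7 _·ₘ_ _⊙_
infixl 6 _-ₘ_ _+ₘ_

_·ₘ_ : Mat2 → Mat2 → Mat2
mat a b c d ·ₘ mat e f g h =
  mat (a ℚ.* e ℚ.+ b ℚ.* g) (a ℚ.* f ℚ.+ b ℚ.* h)
      (c ℚ.* e ℚ.+ d ℚ.* g) (c ℚ.* f ℚ.+ d ℚ.* h)

_+ₘ_ : Mat2 → Mat2 → Mat2
mat a b c d +ₘ mat e f g h = mat (a ℚ.+ e) (b ℚ.+ f) (c ℚ.+ g) (d ℚ.+ h)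

_-ₘ_ : Mat2 → Mat2 → Mat2
mat a b c d -ₘ mat e f g h = mat (a ℚ.- e) (b ℚ.- f) (c ℚ.- g) (d ℚ.- h)

_⊙_ : ℚ → Mat2 → Mat2
t ⊙ mat a b c d = mat (t ℚ.* a) (t ℚ.* b) (t ℚ.* c) (t ℚ.* d)

zeroM : Mat2
zeroM = mat 0ℚ 0ℚ 0ℚ 0ℚ

tr : Mat2 → ℚ
tr m = m11 m ℚ.+ m22 m

det : Mat2 → ℚ
det m = m11 m ℚ.* m22 m ℚ.- m12 m ℚ.* m21 m

InV : Mat2 → Set
InV m = tr m ≡ 0ℚ

Qf : ℕ → Mat2 → ℚ
Qf N m = ιₙ N ℚ.* det m

InL : (N : ℕ) → .{{NonZero N}} → Mat2 → Set
InL N m = ∃[ a ] ∃[ b ] ∃[ c ]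
  (m ≡ mat (ι b) (ℚ.- (a / N)) (ι c) (ℚ.- ι b))

lprime : (N : ℕ) → .{{NonZero N}} → ℤ → ℤ → ℤ → Mat2
lprime N a b c =
  mat (_/_ b (2 ℕ.* N) {{m*n≢0 2 N}}) (ℚ.- (a / N))
      (ι c) (ℚ.- (_/_ b (2 ℕ.* N) {{m*n≢0 2 N}}))

InL' : (N : ℕ) → .{{NonZero N}} → Mat2 → Set
InL' N m = ∃[ a ] ∃[ b ] ∃[ c ] (m ≡ lprime N a b c)

-- μ ∈ L + h   (cosets of L in L' are represented by elements h ∈ L')
InCoset : (N : ℕ) → .{{NonZero N}} → Mat2 → Mat2 → Set
InCoset N h μ = InL N (μ -ₘ h)

-- Isotropic lines.  An isotropic line ℓ ⊂ V is given by a nonzero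
-- isotropic vector v ∈ V spanning it: ℓ = ℚ v.

IsotropicVec : ℕ → Mat2 → Set
IsotropicVec N v = InV v × (v ≢ zeroM) × (Qf N v ≡ 0ℚ)

OnLine : Mat2 → Mat2 → Set
OnLine v μ = ∃[ t ] (μ ≡ t ⊙ v)

record SL2Z : Set where
  constructor sl2
  field
    α β γ δ : ℤ
    detOne : α ℤ.* δ ℤ.- β ℤ.* γ ≡ + 1
open SL2Z public

toMat : SL2Z → Mat2
toMat σ = mat (ι (α σ)) (ι (β σ)) (ι (γ σ)) (ι (δ σ))

toMatInv : SL2Z → Mat2
toMatInv σ = mat (ι (δ σ)) (ι (ℤ.- β σ)) (ι (ℤ.- γ σ)) (ι (α σ))

-- the matrix (0 1 ; 0 0); ℓ∞ = ℚ E
E : Mat2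
E = mat 0ℚ 1ℚ 0ℚ 0ℚ

conjE : SL2Z → Mat2
conjE σ = toMat σ ·ₘ E ·ₘ toMatInv σ

-- σ ℓ∞ σ⁻¹ = ℓ  where ℓ = ℚ v  (i.e. ℚ (σEσ⁻¹) = ℚ v)
IsSigmaFor : Mat2 → SL2Z → Set
IsSigmaFor v σ = ∃[ t ] ((t ≢ 0ℚ) × (conjE σ ≡ t ⊙ v))

IsLambda : (N : ℕ) → .{{NonZero N}} → Mat2 → SL2Z → Mat2 → Set
IsLambda N v σ lam =
  (OnLine v lam × InL N lam)
  × (∀ μ → OnLine v μ → InL N μ → ∃[ k ] (μ ≡ ι k ⊙ lam))
  × ∃[ t ] ((0ℚ ℚ.< t) × (lam ≡ t ⊙ conjE σ))

Meets : (N : ℕ) → .{{NonZero N}} → Mat2 → Mat2 → Set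
Meets N v h = ∃[ μ ] (OnLine v μ × InCoset N h μ)

-- ℓ ∩ (L + h) = ℤ λ_ℓ + h_ℓ  with  h_ℓ = s λ_ℓ
IsHParam : (N : ℕ) → .{{NonZero N}} → Mat2 → Mat2 → Mat2 → ℚ → Set
IsHParam N v lam h s =
  ∀ μ → (OnLine v μ × InCoset N h μ) ⇔ (∃[ k ] (μ ≡ ι k ⊙ lam +ₘ s ⊙ lam))

-- d(ℓ,h) = q where s = p/q in lowest terms  (q = ↧ₙ s)
-- h'_ℓ = (1/d(ℓ,h)) λ_ℓ
hPrime : ℚ → Mat2 → Mat2
hPrime s lam = (+ 1 / (↧ₙ s)) ⊙ lam

minFactorFrom : ℕ → ℕ → ℕ → ℕ
minFactorFrom zero k m = m
minFactorFrom (suc f) k m with k ℕD.∣? m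
... | Relation.Nullary.yes _ = k
... | Relation.Nullary.no _ = minFactorFrom f (suc k) m

minFactor : ℕ → ℕ
minFactor m = minFactorFrom m 2 m

divN : ℕ → ℕ → ℕ
divN m zero = zero
divN m (suc k) = ℕDM._/_ m (suc k)

-- (D/p) for a prime p (Legendre symbol for odd p via Euler's criterion;
-- the Kronecker convention for p = 2)
kronPrime : ℤ → ℕ → ℤ
kronPrime D (suc (suc zero)) =
  if (D %ℕ 2) ≡ᵇ 0 then + 0
  else (if ((D %ℕ 8) ≡ᵇ 1) ∨ ((D %ℕ 8) ≡ᵇ 7) then + 1 else ℤ.-1ℤ)
kronPrime D zero = + 0
kronPrime D (suc p) =
  if (D %ℕ (suc p)) ≡ᵇ 0 then + 0
  else (if ℕDM._%_ ((D %ℕ (suc p)) ℕ.^ ℕDM._/_ p 2) (suc p) ≡ᵇ 1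
        then + 1 else ℤ.-1ℤ)

kronNat : ℕ → ℤ → ℕ → ℤ
kronNat zero D m = + 1
kronNat (suc f) D zero = + 1
kronNat (suc f) D (suc zero) = + 1
kronNat (suc f) D (suc (suc m)) =
  kronPrime D (minFactor (suc (suc m)))
    ℤ.* kronNat f D (divN (suc (suc m)) (minFactor (suc (suc m))))

kronSign : ℤ → ℤ
kronSign (+ _) = + 1
kronSign -[1+ _ ] = ℤ.-1ℤ

kron : ℤ → ℤ → ℤ
kron D (+ zero) = if ∣ D ∣ ≡ᵇ 1 then + 1 else + 0
kron D (+ suc m) = kronNat (suc m) D (suc m)
kron D -[1+ m ] = kronSign D ℤ.* kronNat (suc m) D (suc m)

Represents : ℤ → ℤ → ℤ → ℤ → Set
Represents A B C n = ∃[ x ] ∃[ y ] (n ≡ A ℤ.* x ℤ.* x ℤ.+ B ℤ.* x ℤ.* y ℤ.+ C ℤ.* y ℤ.* y)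

IsSquareMod : ℤ → ℤ → Set
IsSquareMod q m = ∃[ t ] (m ℤD.∣ (t ℤ.* t ℤ.- q))

SquareFreeℤ : ℤ → Set
SquareFreeℤ m = ∀ p → Prime p → ¬ ((+ (p ℕ.* p)) ℤD.∣ m)

SquareFreeℕ : ℕ → Set
SquareFreeℕ m = ∀ p → Prime p → ¬ ((p ℕ.* p) ℕD.∣ m)

-- Δ is a fundamental discriminant (Δ = 1 included)
FundamentalDisc : ℤ → Set
FundamentalDisc D =
  ((+ 4) ℤD.∣ (D ℤ.- + 1) × SquareFreeℤ D)
  ⊎ ∃[ m ] ((D ≡ + 4 ℤ.* m)
            × (((+ 4) ℤD.∣ (m ℤ.- + 2)) ⊎ ((+ 4) ℤD.∣ (m ℤ.- + 3)))
            × SquareFreeℤ m)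

-- The genus character χ_Δ on L'  (as a relation  ChiVal … δ x  meaning
-- χ_Δ(δ) = x).  Written with δ = (b/2N, -a/N ; c, -b/2N).

ChiCond : ℕ → ℤ → ℤ → ℤ → ℤ → Set
ChiCond N D a b c =
  (D ℤD.∣ disc)
  × ∃[ q ] ((disc ≡ q ℤ.* D) × IsSquareMod q (+ (4 ℕ.* N)))
  × (ℤG.gcd (ℤG.gcd (ℤG.gcd a b) c) D ≡ + 1)
  where disc = b ℤ.* b ℤ.- + (4 ℕ.* N) ℤ.* a ℤ.* c

ChiVal : (N : ℕ) → .{{NonZero N}} → ℤ → Mat2 → ℤ → Set
ChiVal N D δ x = ∃[ a ] ∃[ b ] ∃[ c ] ((δ ≡ lprime N a b c) ×
  ( (ChiCond N D a b c
      × ∃[ n ] ((ℤG.gcd n D ≡ + 1) × Represents a b (+ N ℤ.* c) n × (x ≡ kron D n)))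
  ⊎ (¬ ChiCond N D a b c × (x ≡ + 0))))

-- 𝒟_{Δ,r}(ℓ,h) as a relation  DVal N Δ r v lam h x  meaning 𝒟_{Δ,r}(ℓ,h) = x,
-- where ℓ = ℚ v, lam = λ_ℓ, and h ∈ L' represents the coset h ∈ 𝒟.

DVal : (N : ℕ) → .{{NonZero N}} → ℤ → ℤ → Mat2 → Mat2 → Mat2 → ℤ → Set
DVal N D r v lam h x =
  ((D ≡ + 1) × ((Meets N v h × (x ≡ + 1)) ⊎ (¬ Meets N v h × (x ≡ + 0))))
  ⊎ ((D ≢ + 1) × ∃[ s ] (IsHParam N v lam rh s × (D ℤD.∣ (+ (↧ₙ s)))
                          × ChiVal N D (hPrime s lam) x))
  ⊎ ((D ≢ + 1) × ¬ (∃[ s ] (IsHParam N v lam rh s × (D ℤD.∣ (+ (↧ₙ s)))))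
               × (x ≡ + 0))
  where rh = ι r ⊙ h

module Submission where

-- A nonzero value is χ_Δ(h'_ℓ) with h'_ℓ = (1/d)·λ_ℓ, where d = d(ℓ, rh) is divisible by
-- Δ and h'_ℓ = (b/2N, -a/N; c, -b/2N) has gcd(a, b, c, Δ) = 1.  Write λ_ℓ = (B, -A/N; C, -B) ∈ L.
-- Then A = d·a and C = d·c, so a prime p ∣ Δ divides A and C.  Since λ_ℓ spans the isotropic line
-- ℓ, det λ_ℓ = 0, i.e. A·C = N·B².  If p ∤ B this gives p² ∣ N.  If p ∣ B, then λ_ℓ/p ∈ ℓ ∩ L,
-- which is impossible for the generator λ_ℓ unless λ_ℓ = 0; but then a = b = c = 0 and p would
-- divide gcd(a, b, c, Δ) = 1.  For the square-free case, Δ ≠ 1 always has a prime divisor.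

open import Defs
open import Data.Nat using (ℕ; NonZero; _*_)
open import Data.Nat.Divisibility using (_∣_)
open import Data.Nat.Primality using (Prime)
open import Data.Integer as ℤ using (ℤ; +_)
open import Data.Integer.Divisibility as ℤD using ()
open import Data.Product using (_×_)
open import Relation.Binary.PropositionalEquality using (_≡_; _≢_)

open import Data.Nat as ℕ using (zero; suc)
import Data.Nat.Properties as ℕP
import Data.Nat.Divisibility as ℕD
open import Data.Nat.Primality using (¬prime[1]; prime⇒nonZero; euclidsLemma)
open import Data.Nat.Primality.Factorisation using (factorise; factors; PrimeFactorisation)
open PrimeFactorisation using (isFactorisation; factorsPrime)
open import Data.Nat.ListAction using (product)
open import Data.Integer using (-[1+_])
import Data.Integer.Properties as ℤP
import Data.Integer.Divisibility.Signed as S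
import Data.Integer.GCD as ℤG
open import Data.Integer.Tactic.RingSolver using (solve-∀)
open import Data.Rational as ℚ using (_/_; 0ℚ; 1ℚ)
import Data.Rational.Properties as ℚP
open import Data.Rational.Solver using (module +-*-Solver)
open import Data.Rational.Unnormalised as ℚᵘ using (mkℚᵘ; *≡*)
import Data.Rational.Unnormalised.Properties as ℚᵘP
open import Data.List using (_∷_)
open import Data.List.Relation.Unary.All using (All; _∷_)
open import Data.Product using (_,_; ∃-syntax; proj₁; proj₂)
open import Data.Sum using (inj₁; inj₂; [_,_]′)
open import Data.Empty using (⊥; ⊥-elim)
open import Function using (id)
open import Relation.Binary.PropositionalEquality using (refl; sym; trans; cong; cong₂; subst; module ≡-Reasoning)
open import Relation.Nullary using (¬_; contradiction; Dec; yes; no)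
open import Relation.Nullary.Decidable using (from-no; decidable-stable)

fixed⇒zero : ∀ j x → j ≢ + 1 → x ≡ j ℤ.* x → x ≡ + 0
fixed⇒zero j x j≢1 x≡jx =
  [ (λ j-1≡0 → ⊥-elim (j≢1 (ℤP.i-j≡0⇒i≡j j (+ 1) j-1≡0))) , id ]′
    (ℤP.i*j≡0⇒i≡0∨j≡0 (j ℤ.- + 1) j-1*x≡0)
  where
  open ≡-Reasoning
  distrib : ∀ j x → (j ℤ.- + 1) ℤ.* x ≡ j ℤ.* x ℤ.- x
  distrib = solve-∀
  j-1*x≡0 : (j ℤ.- + 1) ℤ.* x ≡ + 0
  j-1*x≡0 = begin
    (j ℤ.- + 1) ℤ.* x  ≡⟨ distrib j x ⟩
    j ℤ.* x ℤ.- x      ≡⟨ cong (ℤ._- x) x≡jx ⟨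
    x ℤ.- x            ≡⟨ ℤP.+-inverseʳ x ⟩
    + 0                ∎

prime*≢1 : ∀ {p} → Prime p → ∀ k → + p ℤ.* k ≢ + 1
prime*≢1 {p} p-prime k pk≡1 = ¬prime[1] (subst Prime p≡1 p-prime)
  where
  p≡1 : p ≡ 1
  p≡1 = ℕP.m*n≡1⇒m≡1 p ℤ.∣ k ∣ (trans (sym (ℤP.abs-* (+ p) k)) (cong ℤ.∣_∣ pk≡1))

multiple-zero : ∀ d .{{_ : NonZero d}} y → + 0 ≡ + d ℤ.* y → y ≡ + 0
multiple-zero d y 0≡dy = ℤP.*-cancelˡ-≡ (+ d) y (+ 0) (trans (sym 0≡dy) (sym (ℤP.*-zeroʳ (+ d))))

∣-multiple : ∀ {p} d x y → p ∣ d → x ≡ + d ℤ.* y → + p ℤD.∣ x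
∣-multiple {p} d x y p∣d x≡dy =
  subst (p ∣_) (sym (trans (cong ℤ.∣_∣ x≡dy) (ℤP.abs-* (+ d) y))) (ℕD.∣m⇒∣m*n ℤ.∣ y ∣ p∣d)

gcd≡1⇒no-common-prime : ∀ {p} a b c Δ → Prime p → ℤG.gcd (ℤG.gcd (ℤG.gcd a b) c) Δ ≡ + 1 →
                        + p ℤD.∣ a → + p ℤD.∣ b → + p ℤD.∣ c → + p ℤD.∣ Δ → ⊥
gcd≡1⇒no-common-prime {p} a b c Δ p-prime gcd≡1 p∣a p∣b p∣c p∣Δ =
  ¬prime[1] (subst Prime (ℕD.∣1⇒≡1 (subst (+ p ℤD.∣_) gcd≡1 p∣gcd)) p-prime)
  where
  p∣ab : + p ℤD.∣ ℤG.gcd a b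
  p∣ab = ℤG.gcd-greatest {a} {b} {+ p} p∣a p∣b
  p∣abc : + p ℤD.∣ ℤG.gcd (ℤG.gcd a b) c
  p∣abc = ℤG.gcd-greatest {ℤG.gcd a b} {c} {+ p} p∣ab p∣c
  p∣gcd : + p ℤD.∣ ℤG.gcd (ℤG.gcd (ℤG.gcd a b) c) Δ
  p∣gcd = ℤG.gcd-greatest {ℤG.gcd (ℤG.gcd a b) c} {Δ} {+ p} p∣abc p∣Δ

prime²-cancel : ∀ {p} n m → Prime p → ¬ p ∣ m → p ℕ.* p ∣ n ℕ.* m → p ℕ.* p ∣ n
prime²-cancel {p} n m p-prime p∤m p²∣nm =
  cancel (euclid n (ℕD.m*n∣⇒m∣ p p p²∣nm)) p²∣nm
  where
  instance
    p≢0 : NonZero p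
    p≢0 = prime⇒nonZero p-prime
  euclid : ∀ x → p ∣ x ℕ.* m → p ∣ x
  euclid x p∣xm = [ id , (λ p∣m → contradiction p∣m p∤m) ]′ (euclidsLemma x m p-prime p∣xm)
  cancel : p ∣ n → p ℕ.* p ∣ n ℕ.* m → p ℕ.* p ∣ n
  cancel (ℕD.divides q refl) p²∣qpm = ℕD.*-monoˡ-∣ p (euclid q p∣qm)
    where
    p∣qm : p ∣ q ℕ.* m
    p∣qm = ℕD.*-cancelˡ-∣ p (subst (p ℕ.* p ∣_) qpm≡pqm p²∣qpm)
      where
      qpm≡pqm : q ℕ.* p ℕ.* m ≡ p ℕ.* (q ℕ.* m)
      qpm≡pqm = trans (cong (ℕ._* m) (ℕP.*-comm q p)) (ℕP.*-assoc p q m)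

square-divides : ∀ {p} N a b c → Prime p → p ∣ a → p ∣ c → ¬ p ∣ b →
                 a ℕ.* c ≡ N ℕ.* (b ℕ.* b) → p ℕ.* p ∣ N
square-divides {p} N a b c p-prime p∣a p∣c p∤b ac≡Nb² =
  prime²-cancel N (b ℕ.* b) p-prime p∤b² (subst (p ℕ.* p ∣_) ac≡Nb² (ℕD.*-pres-∣ p∣a p∣c))
  where
  p∤b² : ¬ p ∣ b ℕ.* b
  p∤b² p∣b² = [ p∤b , p∤b ]′ (euclidsLemma b b p-prime p∣b²)

prime-divisor : ∀ k → ∃[ p ] (Prime p × p ∣ suc (suc k))
prime-divisor k = first-factor (factors F) (isFactorisation F) (factorsPrime F)
  where
  F : PrimeFactorisation (suc (suc k))
  F = factorise (suc (suc k))
  first-factor : ∀ ps → suc (suc k) ≡ product ps → All Prime ps → ∃[ p ] (Prime p × p ∣ suc (suc k))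
  first-factor (p ∷ ps) n≡p*ps (p-prime ∷ _) = p , p-prime , subst (p ∣_) (sym n≡p*ps) (ℕD.m∣m*n (product ps))

¬disc0 : ¬ FundamentalDisc (+ 0)
¬disc0 (inj₁ (4∣1 , _)) = from-no (4 ℕD.∣? 1) 4∣1
¬disc0 (inj₂ (+ 0 , _ , inj₁ 4∣2 , _)) = from-no (4 ℕD.∣? 2) 4∣2
¬disc0 (inj₂ (+ 0 , _ , inj₂ 4∣3 , _)) = from-no (4 ℕD.∣? 3) 4∣3
¬disc0 (inj₂ (+ suc j , () , _))
¬disc0 (inj₂ (-[1+ j ] , () , _))

¬disc-1 : ¬ FundamentalDisc (-[1+ 0 ])
¬disc-1 (inj₁ (4∣2 , _)) = from-no (4 ℕD.∣? 2) 4∣2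
¬disc-1 (inj₂ (+ 0 , () , _))
¬disc-1 (inj₂ (+ suc j , () , _))
¬disc-1 (inj₂ (-[1+ zero ] , () , _))
¬disc-1 (inj₂ (-[1+ suc j ] , () , _))

disc-prime-divisor : ∀ Δ → FundamentalDisc Δ → Δ ≢ + 1 → ∃[ p ] (Prime p × + p ℤD.∣ Δ)
disc-prime-divisor (+ 0)             disc Δ≢1 = ⊥-elim (¬disc0 disc)
disc-prime-divisor (+ 1)             disc Δ≢1 = ⊥-elim (Δ≢1 refl)
disc-prime-divisor (+ suc (suc k))   disc Δ≢1 = prime-divisor k
disc-prime-divisor -[1+ 0 ]          disc Δ≢1 = ⊥-elim (¬disc-1 disc)
disc-prime-divisor -[1+ suc k ]      disc Δ≢1 = prime-divisor k

/-≡⇒cross : ∀ x y n m .{{_ : NonZero n}} .{{_ : NonZero m}} →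
            x / n ≡ y / m → x ℤ.* + m ≡ y ℤ.* + n
/-≡⇒cross x y (suc n) (suc m) eq with ℚP.fromℚᵘ-injective {mkℚᵘ x n} {mkℚᵘ y m} eq
... | *≡* cross = cross

/-*-/ : ∀ x y n m .{{_ : NonZero n}} .{{_ : NonZero m}} →
        (x / n) ℚ.* (y / m) ≡ _/_ (x ℤ.* y) (n ℕ.* m) {{ℕP.m*n≢0 n m}}
/-*-/ x y (suc n) (suc m) = ℚP.toℚᵘ-injective (begin
  ℚ.toℚᵘ ((x / suc n) ℚ.* (y / suc m))
    ≈⟨ ℚP.toℚᵘ-homo-* (x / suc n) (y / suc m) ⟩
  ℚ.toℚᵘ (x / suc n) ℚᵘ.* ℚ.toℚᵘ (y / suc m)
    ≈⟨ ℚᵘP.*-cong (ℚP.toℚᵘ-fromℚᵘ (mkℚᵘ x n)) (ℚP.toℚᵘ-fromℚᵘ (mkℚᵘ y m)) ⟩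
  mkℚᵘ x n ℚᵘ.* mkℚᵘ y m
    ≈⟨ ℚᵘP.≃-sym (ℚP.toℚᵘ-fromℚᵘ (mkℚᵘ x n ℚᵘ.* mkℚᵘ y m)) ⟩
  ℚ.toℚᵘ ((x ℤ.* y) / (suc n ℕ.* suc m)) ∎)
  where open ℚᵘP.≃-Reasoning

ι-* : ∀ a b → ι a ℚ.* ι b ≡ ι (a ℤ.* b)
ι-* a b = /-*-/ a b 1 1

ι-injective : ∀ {a b} → ι a ≡ ι b → a ≡ b
ι-injective {a} {b} eq = begin
  a           ≡⟨ ℤP.*-identityʳ a ⟨
  a ℤ.* + 1   ≡⟨ /-≡⇒cross a b 1 1 eq ⟩
  b ℤ.* + 1   ≡⟨ ℤP.*-identityʳ b ⟩
  b           ∎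
  where open ≡-Reasoning

ιₙ-nonZero : ∀ n .{{_ : NonZero n}} → ιₙ n ≢ 0ℚ
ιₙ-nonZero n eq = ℕ.≢-nonZero⁻¹ n (ℤP.+-injective (ι-injective (trans eq (sym (ℚP.0/n≡0 1)))))

*-zero-divisor : ∀ p q → p ≢ 0ℚ → p ℚ.* q ≡ 0ℚ → q ≡ 0ℚ
*-zero-divisor p q p≢0 pq≡0 = begin
  q                          ≡⟨ ℚP.*-identityˡ q ⟨
  1ℚ ℚ.* q                   ≡⟨ cong (ℚ._* q) (ℚP.*-inverseˡ p) ⟨
  (ℚ.1/ p ℚ.* p) ℚ.* q       ≡⟨ ℚP.*-assoc (ℚ.1/ p) p q ⟩
  ℚ.1/ p ℚ.* (p ℚ.* q)       ≡⟨ cong (ℚ.1/ p ℚ.*_) pq≡0 ⟩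
  ℚ.1/ p ℚ.* 0ℚ              ≡⟨ ℚP.*-zeroʳ (ℚ.1/ p) ⟩
  0ℚ                         ∎
  where
  open ≡-Reasoning
  instance
    p-nonZero : ℚ.NonZero p
    p-nonZero = ℚ.≢-nonZero p≢0

mat-cong : ∀ {a b c d a' b' c' d'} →
           a ≡ a' → b ≡ b' → c ≡ c' → d ≡ d' → mat a b c d ≡ mat a' b' c' d'
mat-cong refl refl refl refl = refl

⊙-identityˡ : ∀ m → 1ℚ ⊙ m ≡ m
⊙-identityˡ (mat a b c d) =
  mat-cong (ℚP.*-identityˡ a) (ℚP.*-identityˡ b) (ℚP.*-identityˡ c) (ℚP.*-identityˡ d)

⊙-assoc : ∀ s t m → s ⊙ (t ⊙ m) ≡ (s ℚ.* t) ⊙ m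
⊙-assoc s t (mat a b c d) =
  sym (mat-cong (ℚP.*-assoc s t a) (ℚP.*-assoc s t b) (ℚP.*-assoc s t c) (ℚP.*-assoc s t d))

det-⊙ : ∀ t m → det (t ⊙ m) ≡ (t ℚ.* t) ℚ.* det m
det-⊙ t (mat a b c d) =
  solve 5 (λ t a b c d → (t :* a) :* (t :* d) :- (t :* b) :* (t :* c)
                         := (t :* t) :* (a :* d :- b :* c)) refl t a b c d
  where open +-*-Solver

isotropic-det : ∀ N .{{_ : NonZero N}} {v} t → IsotropicVec N v → det (t ⊙ v) ≡ 0ℚ
isotropic-det N {v} t (_ , _ , Qv≡0) = begin
  det (t ⊙ v)            ≡⟨ det-⊙ t v ⟩
  (t ℚ.* t) ℚ.* det v    ≡⟨ cong ((t ℚ.* t) ℚ.*_) det-v≡0 ⟩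
  (t ℚ.* t) ℚ.* 0ℚ       ≡⟨ ℚP.*-zeroʳ (t ℚ.* t) ⟩
  0ℚ                     ∎
  where
  open ≡-Reasoning
  det-v≡0 : det v ≡ 0ℚ
  det-v≡0 = *-zero-divisor (ιₙ N) (det v) (ιₙ-nonZero N) Qv≡0

Lmat : (N : ℕ) → .{{NonZero N}} → ℤ → ℤ → ℤ → Mat2
Lmat N a b c = mat (ι b) (ℚ.- (a / N)) (ι c) (ℚ.- ι b)

Lmat-scale : ∀ N .{{_ : NonZero N}} k a b c →
             ι k ⊙ Lmat N a b c ≡ Lmat N (k ℤ.* a) (k ℤ.* b) (k ℤ.* c)
Lmat-scale N k a b c = mat-cong (ι-* k b) scale-a (ι-* k c) scale-b
  where
  open ≡-Reasoning
  scale-a : ι k ℚ.* ℚ.- (a / N) ≡ ℚ.- ((k ℤ.* a) / N)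
  scale-a = begin
    ι k ℚ.* ℚ.- (a / N)         ≡⟨ ℚP.neg-distribʳ-* (ι k) (a / N) ⟨
    ℚ.- (ι k ℚ.* (a / N))       ≡⟨ cong ℚ.-_ (/-*-/ k a 1 N) ⟩
    ℚ.- (_/_ (k ℤ.* a) (1 ℕ.* N) {{ℕP.m*n≢0 1 N}})
      ≡⟨ cong ℚ.-_ (ℚP./-cong {k ℤ.* a} {{ℕP.m*n≢0 1 N}} refl (ℕP.*-identityˡ N)) ⟩
    ℚ.- ((k ℤ.* a) / N)         ∎
  scale-b : ι k ℚ.* ℚ.- ι b ≡ ℚ.- ι (k ℤ.* b)
  scale-b = trans (sym (ℚP.neg-distribʳ-* (ι k) (ι b))) (cong ℚ.-_ (ι-* k b))

Lmat-injective : ∀ N .{{_ : NonZero N}} {a b c a' b' c'} →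
                 Lmat N a b c ≡ Lmat N a' b' c' → a ≡ a' × b ≡ b' × c ≡ c'
Lmat-injective N {a} {b} {c} {a'} {b'} {c'} eq =
  ℤP.*-cancelʳ-≡ a a' (+ N) (/-≡⇒cross a a' N N (ℚP.neg-injective (cong m12 eq))) ,
  ι-injective (cong m11 eq) ,
  ι-injective (cong m21 eq)

Lmat-det : ∀ N .{{_ : NonZero N}} a b c → det (Lmat N a b c) ≡ 0ℚ → a ℤ.* c ≡ + N ℤ.* (b ℤ.* b)
Lmat-det N a b c det≡0 = begin
  a ℤ.* c                    ≡⟨ ℤP.*-identityʳ (a ℤ.* c) ⟨
  a ℤ.* c ℤ.* + 1            ≡⟨ /-≡⇒cross (a ℤ.* c) (b ℤ.* b) (N ℕ.* 1) 1 {{ℕP.m*n≢0 N 1}} fractions ⟩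
  b ℤ.* b ℤ.* + (N ℕ.* 1)    ≡⟨ cong (λ n → b ℤ.* b ℤ.* + n) (ℕP.*-identityʳ N) ⟩
  b ℤ.* b ℤ.* + N            ≡⟨ ℤP.*-comm (b ℤ.* b) (+ N) ⟩
  + N ℤ.* (b ℤ.* b)          ∎
  where
  open ≡-Reasoning
  open +-*-Solver
  expand : ∀ x y z → y ℚ.* ℚ.- y ℚ.- ℚ.- x ℚ.* z ≡ x ℚ.* z ℚ.- y ℚ.* y
  expand = solve 3 (λ x y z → y :* (:- y) :- (:- x) :* z := x :* z :- y :* y) refl
  split : ∀ x y → x ≡ (x ℚ.- y) ℚ.+ y
  split = solve 2 (λ x y → x := (x :- y) :+ y) refl
  fractions : _/_ (a ℤ.* c) (N ℕ.* 1) {{ℕP.m*n≢0 N 1}} ≡ (b ℤ.* b) / 1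
  fractions = begin
    _/_ (a ℤ.* c) (N ℕ.* 1) {{ℕP.m*n≢0 N 1}} ≡⟨ /-*-/ a c N 1 ⟨
    (a / N) ℚ.* ι c                          ≡⟨ split ((a / N) ℚ.* ι c) (ι b ℚ.* ι b) ⟩
    ((a / N) ℚ.* ι c ℚ.- ι b ℚ.* ι b) ℚ.+ ι b ℚ.* ι b
      ≡⟨ cong (ℚ._+ ι b ℚ.* ι b) (trans (sym (expand (a / N) (ι b) (ι c))) det≡0) ⟩
    0ℚ ℚ.+ ι b ℚ.* ι b                       ≡⟨ ℚP.+-identityˡ (ι b ℚ.* ι b) ⟩
    ι b ℚ.* ι b                              ≡⟨ ι-* b b ⟩
    (b ℤ.* b) / 1                            ∎

descale-entry : ∀ d n m .{{_ : NonZero d}} .{{_ : NonZero n}} .{{_ : NonZero m}} x y →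
                (+ 1 / d) ℚ.* (x / n) ≡ y / m → x ℤ.* + m ≡ + d ℤ.* y ℤ.* + n
descale-entry d n m x y eq = begin
  x ℤ.* + m                      ≡⟨ cong (ℤ._* + m) (ℤP.*-identityˡ x) ⟨
  + 1 ℤ.* x ℤ.* + m              ≡⟨ /-≡⇒cross (+ 1 ℤ.* x) y (d ℕ.* n) m {{ℕP.m*n≢0 d n}}
                                      (trans (sym (/-*-/ (+ 1) x d n)) eq) ⟩
  y ℤ.* + (d ℕ.* n)              ≡⟨ cong (y ℤ.*_) (ℤP.pos-* d n) ⟩
  y ℤ.* (+ d ℤ.* + n)            ≡⟨ rearrange y (+ d) (+ n) ⟩
  + d ℤ.* y ℤ.* + n              ∎
  where
  open ≡-Reasoning
  rearrange : ∀ y d n → y ℤ.* (d ℤ.* n) ≡ d ℤ.* y ℤ.* n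
  rearrange = solve-∀

descale : ∀ N d .{{_ : NonZero N}} .{{_ : NonZero d}} A B C a b c →
          (+ 1 / d) ⊙ Lmat N A B C ≡ lprime N a b c →
          A ≡ + d ℤ.* a × B ℤ.* + (2 ℕ.* N) ≡ + d ℤ.* b × C ≡ + d ℤ.* c
descale N d A B C a b c eq = A≡da , B2N≡db , C≡dc
  where
  open ≡-Reasoning
  instance
    2N≢0 : NonZero (2 ℕ.* N)
    2N≢0 = ℕP.m*n≢0 2 N
  A≡da : A ≡ + d ℤ.* a
  A≡da = ℤP.*-cancelʳ-≡ A (+ d ℤ.* a) (+ N) (descale-entry d N N A a (ℚP.neg-injective (begin
    ℚ.- ((+ 1 / d) ℚ.* (A / N))  ≡⟨ ℚP.neg-distribʳ-* (+ 1 / d) (A / N) ⟩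
    (+ 1 / d) ℚ.* ℚ.- (A / N)    ≡⟨ cong m12 eq ⟩
    ℚ.- (a / N)                  ∎)))
  B2N≡db : B ℤ.* + (2 ℕ.* N) ≡ + d ℤ.* b
  B2N≡db = trans (descale-entry d 1 (2 ℕ.* N) B b (cong m11 eq)) (ℤP.*-identityʳ (+ d ℤ.* b))
  C≡dc : C ≡ + d ℤ.* c
  C≡dc = begin
    C                    ≡⟨ ℤP.*-identityʳ C ⟨
    C ℤ.* + 1            ≡⟨ descale-entry d 1 1 C c (cong m21 eq) ⟩
    + d ℤ.* c ℤ.* + 1    ≡⟨ ℤP.*-identityʳ (+ d ℤ.* c) ⟩
    + d ℤ.* c            ∎

Primitive : (N : ℕ) → .{{NonZero N}} → Mat2 → Mat2 → Set
Primitive N v lam = ∀ μ → OnLine v μ → InL N μ → ∃[ k ] (μ ≡ ι k ⊙ lam)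

divisor-on-line : ∀ {v} p μ → p ≢ 0ℚ → OnLine v (p ⊙ μ) → OnLine v μ
divisor-on-line {v} p μ p≢0 (t , pμ≡tv) = ℚ.1/ p ℚ.* t , (begin
    μ                        ≡⟨ ⊙-identityˡ μ ⟨
    1ℚ ⊙ μ                   ≡⟨ cong (_⊙ μ) (ℚP.*-inverseˡ p) ⟨
    (ℚ.1/ p ℚ.* p) ⊙ μ       ≡⟨ ⊙-assoc (ℚ.1/ p) p μ ⟨
    ℚ.1/ p ⊙ (p ⊙ μ)         ≡⟨ cong (ℚ.1/ p ⊙_) pμ≡tv ⟩
    ℚ.1/ p ⊙ (t ⊙ v)         ≡⟨ ⊙-assoc (ℚ.1/ p) t v ⟩
    (ℚ.1/ p ℚ.* t) ⊙ v       ∎)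
  where
  open ≡-Reasoning
  instance
    p-nonZero : ℚ.NonZero p
    p-nonZero = ℚ.≢-nonZero p≢0

-- A generator λ of ℓ ∩ L is not p-divisible in L unless it is zero:
-- λ = p μ puts μ on ℓ, so μ = k λ and λ = (p k) λ with p k ≠ 1.
primitive-indivisible : ∀ N .{{_ : NonZero N}} {v p} a b c → Prime p →
  OnLine v (Lmat N a b c) → Primitive N v (Lmat N a b c) →
  + p S.∣ a → + p S.∣ b → + p S.∣ c → a ≡ + 0 × b ≡ + 0 × c ≡ + 0
primitive-indivisible N {v} {p} a b c p-prime λ-on-line prim
  (S.divides a' a≡a'p) (S.divides b' b≡b'p) (S.divides c' c≡c'p) =
  fixed⇒zero pk a pk≢1 (proj₁ fixed) ,
  fixed⇒zero pk b pk≢1 (proj₁ (proj₂ fixed)) ,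
  fixed⇒zero pk c pk≢1 (proj₂ (proj₂ fixed))
  where
  open ≡-Reasoning
  lam μ : Mat2
  lam = Lmat N a b c
  μ = Lmat N a' b' c'
  λ≡pμ : lam ≡ ι (+ p) ⊙ μ
  λ≡pμ = begin
    Lmat N a b c                                  ≡⟨ cong₂ (λ x y → Lmat N x y c) a≡pa' b≡pb' ⟩
    Lmat N (+ p ℤ.* a') (+ p ℤ.* b') c            ≡⟨ cong (Lmat N (+ p ℤ.* a') (+ p ℤ.* b')) c≡pc' ⟩
    Lmat N (+ p ℤ.* a') (+ p ℤ.* b') (+ p ℤ.* c') ≡⟨ Lmat-scale N (+ p) a' b' c' ⟨
    ι (+ p) ⊙ μ                                   ∎
    where
    a≡pa' : a ≡ + p ℤ.* a'
    a≡pa' = trans a≡a'p (ℤP.*-comm a' (+ p))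
    b≡pb' : b ≡ + p ℤ.* b'
    b≡pb' = trans b≡b'p (ℤP.*-comm b' (+ p))
    c≡pc' : c ≡ + p ℤ.* c'
    c≡pc' = trans c≡c'p (ℤP.*-comm c' (+ p))
  μ-multiple : ∃[ k ] (μ ≡ ι k ⊙ lam)
  μ-multiple = prim μ (divisor-on-line (ι (+ p)) μ (ιₙ-nonZero p {{prime⇒nonZero p-prime}})
                                       (subst (OnLine v) λ≡pμ λ-on-line))
                    (a' , b' , c' , refl)
  k pk : ℤ
  k = proj₁ μ-multiple
  pk = + p ℤ.* k
  pk≢1 : pk ≢ + 1
  pk≢1 = prime*≢1 p-prime k
  λ≡pkλ : lam ≡ Lmat N (pk ℤ.* a) (pk ℤ.* b) (pk ℤ.* c)
  λ≡pkλ = begin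
    lam                        ≡⟨ λ≡pμ ⟩
    ι (+ p) ⊙ μ                ≡⟨ cong (ι (+ p) ⊙_) (proj₂ μ-multiple) ⟩
    ι (+ p) ⊙ (ι k ⊙ lam)      ≡⟨ ⊙-assoc (ι (+ p)) (ι k) lam ⟩
    (ι (+ p) ℚ.* ι k) ⊙ lam    ≡⟨ cong (_⊙ lam) (ι-* (+ p) k) ⟩
    ι pk ⊙ lam                 ≡⟨ Lmat-scale N pk a b c ⟩
    Lmat N (pk ℤ.* a) (pk ℤ.* b) (pk ℤ.* c) ∎
  fixed : a ≡ pk ℤ.* a × b ≡ pk ℤ.* b × c ≡ pk ℤ.* c
  fixed = Lmat-injective N λ≡pkλ

-- Let λ = (B, -A/N; C, -B) generate ℓ ∩ L for an isotropic
-- line ℓ = ℚ v, and let (1/d)·λ = (b/2N, -a/N; c, -b/2N) with gcd(a, b, c, Δ) = 1.  Then every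
-- prime p dividing both Δ and d has p² ∣ N: p divides A = d a and C = d c but, by primitivity
-- and the gcd condition, not B, so A·C = N·B² leaves p² ∣ N.
common-prime-square-divides : ∀ N .{{_ : NonZero N}} {v p} d .{{_ : NonZero d}} Δ A B C a b c →
  IsotropicVec N v → OnLine v (Lmat N A B C) → Primitive N v (Lmat N A B C) →
  (+ 1 / d) ⊙ Lmat N A B C ≡ lprime N a b c → ℤG.gcd (ℤG.gcd (ℤG.gcd a b) c) Δ ≡ + 1 →
  Prime p → p ∣ d → + p ℤD.∣ Δ → p ℕ.* p ∣ N
common-prime-square-divides N {v} {p} d Δ A B C a b c isotropic λ-on-line prim λ/d≡abc
  gcd≡1 p-prime p∣d p∣Δ = by-cases (p ℕD.∣? ℤ.∣ B ∣)
  where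
  open ≡-Reasoning
  entries : A ≡ + d ℤ.* a × B ℤ.* + (2 ℕ.* N) ≡ + d ℤ.* b × C ≡ + d ℤ.* c
  entries = descale N d A B C a b c λ/d≡abc
  A≡da : A ≡ + d ℤ.* a
  A≡da = proj₁ entries
  B2N≡db : B ℤ.* + (2 ℕ.* N) ≡ + d ℤ.* b
  B2N≡db = proj₁ (proj₂ entries)
  C≡dc : C ≡ + d ℤ.* c
  C≡dc = proj₂ (proj₂ entries)
  p∣A : + p ℤD.∣ A
  p∣A = ∣-multiple d A a p∣d A≡da
  p∣C : + p ℤD.∣ C
  p∣C = ∣-multiple d C c p∣d C≡dc
  AC≡NB² : A ℤ.* C ≡ + N ℤ.* (B ℤ.* B)
  AC≡NB² = Lmat-det N A B C
    (trans (cong det (proj₂ λ-on-line)) (isotropic-det N (proj₁ λ-on-line) isotropic))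
  ∣AC∣≡N∣B∣² : ℤ.∣ A ∣ ℕ.* ℤ.∣ C ∣ ≡ N ℕ.* (ℤ.∣ B ∣ ℕ.* ℤ.∣ B ∣)
  ∣AC∣≡N∣B∣² = begin
    ℤ.∣ A ∣ ℕ.* ℤ.∣ C ∣             ≡⟨ ℤP.abs-* A C ⟨
    ℤ.∣ A ℤ.* C ∣                   ≡⟨ cong ℤ.∣_∣ AC≡NB² ⟩
    ℤ.∣ + N ℤ.* (B ℤ.* B) ∣         ≡⟨ ℤP.abs-* (+ N) (B ℤ.* B) ⟩
    N ℕ.* ℤ.∣ B ℤ.* B ∣             ≡⟨ cong (N ℕ.*_) (ℤP.abs-* B B) ⟩
    N ℕ.* (ℤ.∣ B ∣ ℕ.* ℤ.∣ B ∣)     ∎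
  p∣zero : ∀ {x} → x ≡ + 0 → + p ℤD.∣ x
  p∣zero refl = p ℕD.∣0
  by-cases : Dec (p ∣ ℤ.∣ B ∣) → p ℕ.* p ∣ N
  by-cases (no p∤B) = square-divides N ℤ.∣ A ∣ ℤ.∣ B ∣ ℤ.∣ C ∣ p-prime p∣A p∣C p∤B ∣AC∣≡N∣B∣²
  by-cases (yes p∣B) = ⊥-elim (gcd≡1⇒no-common-prime a b c Δ p-prime gcd≡1
                                 (p∣zero a≡0) (p∣zero b≡0) (p∣zero c≡0) p∣Δ)
    where
    λ≡0 : A ≡ + 0 × B ≡ + 0 × C ≡ + 0
    λ≡0 = primitive-indivisible N A B C p-prime λ-on-line prim
            (S.∣ᵤ⇒∣ p∣A) (S.∣ᵤ⇒∣ p∣B) (S.∣ᵤ⇒∣ p∣C)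
    a≡0 : a ≡ + 0
    a≡0 = multiple-zero d a (trans (sym (proj₁ λ≡0)) A≡da)
    b≡0 : b ≡ + 0
    b≡0 = multiple-zero d b (trans (cong (ℤ._* + (2 ℕ.* N)) (sym (proj₁ (proj₂ λ≡0)))) B2N≡db)
    c≡0 : c ≡ + 0
    c≡0 = multiple-zero d c (trans (sym (proj₂ (proj₂ λ≡0))) C≡dc)

GenusSupport : (N : ℕ) → .{{NonZero N}} → ℤ → Mat2 → Set
GenusSupport N Δ lam = ∃[ s ] (Δ ℤD.∣ + (ℚ.↧ₙ s) × ∃[ a ] ∃[ b ] ∃[ c ]
  (hPrime s lam ≡ lprime N a b c × ℤG.gcd (ℤG.gcd (ℤG.gcd a b) c) Δ ≡ + 1))

DVal-nonzero : ∀ N .{{_ : NonZero N}} Δ r v lam h x → Δ ≢ + 1 →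
               DVal N Δ r v lam h x → x ≢ + 0 → GenusSupport N Δ lam
DVal-nonzero N Δ r v lam h x Δ≢1 (inj₁ (Δ≡1 , _)) x≢0 = ⊥-elim (Δ≢1 Δ≡1)
DVal-nonzero N Δ r v lam h x Δ≢1 (inj₂ (inj₂ (_ , _ , x≡0))) x≢0 = ⊥-elim (x≢0 x≡0)
DVal-nonzero N Δ r v lam h x Δ≢1
  (inj₂ (inj₁ (_ , _ , _ , _ , _ , _ , _ , _ , inj₂ (_ , x≡0)))) x≢0 = ⊥-elim (x≢0 x≡0)
DVal-nonzero N Δ r v lam h x Δ≢1
  (inj₂ (inj₁ (_ , s , _ , Δ∣d , a , b , c , h'≡abc , inj₁ ((_ , _ , _ , gcd≡1) , _)))) x≢0 =
  s , Δ∣d , a , b , c , h'≡abc , gcd≡1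

DVal-nonzero⇒square-divides : (N : ℕ) → .{{_ : NonZero N}} → (Δ r : ℤ) → Δ ≢ + 1 →
  ∀ (v : Mat2) → IsotropicVec N v → (σ : SL2Z) → IsSigmaFor v σ →
  (lam : Mat2) → IsLambda N v σ lam → (h : Mat2) → InL' N h →
  (x : ℤ) → DVal N Δ r v lam h x → x ≢ + 0 →
  (p : ℕ) → Prime p → + p ℤD.∣ Δ → p ℕ.* p ∣ N
DVal-nonzero⇒square-divides N Δ r Δ≢1 v isotropic σ _ .(Lmat N A B C)
  ((λ-on-line , A , B , C , refl) , prim , _) h _ x 𝒟≡x x≢0 p p-prime p∣Δ
  with DVal-nonzero N Δ r v (Lmat N A B C) h x Δ≢1 𝒟≡x x≢0
... | s , Δ∣d , a , b , c , h'≡abc , gcd≡1 =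
  common-prime-square-divides N (ℚ.↧ₙ s) Δ A B C a b c isotropic λ-on-line prim h'≡abc gcd≡1
    p-prime (ℕD.∣-trans p∣Δ Δ∣d) p∣Δ

squarefree⇒DVal-zero : (N : ℕ) → .{{_ : NonZero N}} → (Δ r : ℤ) → FundamentalDisc Δ → Δ ≢ + 1 →
  SquareFreeℕ N →
  ∀ (v : Mat2) → IsotropicVec N v → (σ : SL2Z) → IsSigmaFor v σ →
  (lam : Mat2) → IsLambda N v σ lam → (h : Mat2) → InL' N h →
  (x : ℤ) → DVal N Δ r v lam h x → x ≡ + 0
squarefree⇒DVal-zero N Δ r disc Δ≢1 squarefree v isotropic σ σ-ok lam λ-ok h h∈L' x 𝒟≡x =
  decidable-stable (x ℤ.≟ + 0) λ x≢0 →
    squarefree p p-prime (DVal-nonzero⇒square-divides N Δ r Δ≢1 v isotropic σ σ-ok lam λ-ok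
                            h h∈L' x 𝒟≡x x≢0 p p-prime p∣Δ)
  where
  prime-of-Δ : ∃[ p ] (Prime p × + p ℤD.∣ Δ)
  prime-of-Δ = disc-prime-divisor Δ disc Δ≢1
  p : ℕ
  p = proj₁ prime-of-Δ
  p-prime : Prime p
  p-prime = proj₁ (proj₂ prime-of-Δ)
  p∣Δ : + p ℤD.∣ Δ
  p∣Δ = proj₂ (proj₂ prime-of-Δ)

-- Proposition 5.4.
proposition5p4 :
    (N : ℕ) → .{{_ : NonZero N}} → (Δ r : ℤ) →
    FundamentalDisc Δ → (+ (4 * N)) ℤD.∣ (Δ ℤ.- r ℤ.* r) → Δ ≢ + 1 →
    (∀ (v : Mat2) → IsotropicVec N v → (σ : SL2Z) → IsSigmaFor v σ →
      (lam : Mat2) → IsLambda N v σ lam → (h : Mat2) → InL' N h →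
      (x : ℤ) → DVal N Δ r v lam h x → x ≢ + 0 →
      (p : ℕ) → Prime p → (+ p) ℤD.∣ Δ → (p * p) ∣ N)
    ×
    (SquareFreeℕ N →
      ∀ (v : Mat2) → IsotropicVec N v → (σ : SL2Z) → IsSigmaFor v σ →
      (lam : Mat2) → IsLambda N v σ lam → (h : Mat2) → InL' N h →
      (x : ℤ) → DVal N Δ r v lam h x → x ≡ + 0)
proposition5p4 N Δ r disc _ Δ≢1 =
  DVal-nonzero⇒square-divides N Δ r Δ≢1 , squarefree⇒DVal-zero N Δ r disc Δ≢1
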